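{- Let $P_n$ be the path with vertices $1,\dots,n$ and edges $\{i,i+1\}$ ($1\le i<n$), and let $f,g$ be consistent $2$-colorings of $P_n$ such that $f(i)=g(i)\neq f(i+1)=g(i+1)$ for all $i\in\{2,\dots,n-2\}$, and $f(1)=g(n)\neq g(1)=f(n)$. Then there exist matchings $S_1,S_2$ of $P_n$ with $f\langle S_1,S_2\rangle=g$.
   Context: A $2$-coloring is a map $f:\{1,\dots,n\}\to\{1,2\}$; $f,g$ are consistent if $|f^{ -1}(i)|=|g^{ -1}(i)|$ for $i=1,2$. For a matching $S$, $fS(u)=f(v)$ if $\{u,v\}\in S$ and $fS(u)=f(u)$ if $u$ is covered by no edge of $S$; $f\langle S_1,S_2\rangle=(fS_1)S_2$. -}

module Defs where

open import Data.Nat using (ℕ; zero; suc; _<_; _<?_)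
open import Data.Bool using (Bool; true; false)
open import Data.Fin using (Fin; zero; suc; toℕ; fromℕ<; inject₁)
open import Data.Fin.Properties using (_≟_)
open import Data.List using (List; length; filter)
open import Data.List.Base using ()
open import Data.Fin.Base using ()
open import Data.List using (allFin)
open import Relation.Nullary using (yes; no)
open import Relation.Binary.PropositionalEquality using (_≡_)

-- Vertices of the path P_n are 0 , … , n-1 (paper: 1 , … , n); edge e is {e , e+1}.
Coloring : ℕ → Set
Coloring n = Fin n → Fin 2

count : {n : ℕ} → Fin 2 → Coloring n → ℕ
count {n} c f = length (filter (λ v → f v ≟ c) (allFin n))

Consistent : {n : ℕ} → Coloring n → Coloring n → Set
Consistent f g = ∀ (c : Fin 2) → count c f ≡ count c g

record Matching (n : ℕ) : Set where
  field
    edge     : ℕ → Bool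
    inRange  : ∀ e → edge e ≡ true → suc e < n
    disjoint : ∀ e → edge e ≡ true → edge (suc e) ≡ false
open Matching public

partnerUp : {n : ℕ} → Matching n → Fin n → Fin n
partnerUp {n} S v with edge S (toℕ v) | suc (toℕ v) <? n
... | true | yes p = fromℕ< p
... | _    | _     = v

partner : {n : ℕ} → Matching n → Fin n → Fin n
partner {suc n} S (suc j) with edge S (toℕ j)
... | true  = inject₁ j
... | false = partnerUp S (suc j)
partner S v = partnerUp S v

applyM : {n : ℕ} → Coloring n → Matching n → Coloring n
applyM f S u = f (partner S u)

apply2 : {n : ℕ} → Coloring n → Matching n → Matching n → Coloring n
apply2 f S₁ S₂ = applyM (applyM f S₁) S₂

-- Number the vertices 0 , … , n and put a = f 0, b = g 0. Suppose first f 1 = b. The hypotheses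
-- (with consistency supplying f 1 = g 1 when n = 2, the only case where the middle conditions say
-- nothing) force f = a b a b … on 0 , … , n-1 and f n = b, while g agrees with f in between and
-- has g 0 = b, g n = a. Let E pair {0,1}, {2,3}, … and O pair {1,2}, {3,4}, …. Exchanging colours
-- along E turns f into the alternating colouring b a b a …, and exchanging along O then yields g;
-- so f⟨E,O⟩ = g. If instead f 1 = a, the hypotheses hold for (g , f) with g 1 = f 1 = a = f 0,
-- so g⟨E,O⟩ = f, and f⟨O,E⟩ = g follows because every matching acts by an involution.
module Submission where

open import Defs
open import Data.Bool using (Bool; true; false; not; _∧_; if_then_else_)
open import Data.Bool.Properties using (∧-conicalˡ; ∧-conicalʳ; ∧-zeroʳ; not-injective)
open import Data.Fin using (Fin; zero; suc; toℕ; fromℕ; fromℕ<)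
open import Data.Fin.Properties using (_≟_; toℕ-fromℕ; toℕ-fromℕ<; fromℕ<-toℕ; fromℕ<-cong; toℕ-inject₁; toℕ<n; toℕ-injective)
open import Data.List using (List; []; _∷_; length; filter; map; tabulate)
open import Data.List.Properties using (length-map; map-tabulate)
open import Data.Nat using (ℕ; zero; suc; _≤_; _<_; z≤n; s≤s; s≤s⁻¹)
open import Data.Nat.Properties using (_<?_; ≤-refl; <⇒≤; ≤⇒≯; m≤n⇒m<n∨m≡n)
open import Data.Product using (Σ; _×_; _,_; proj₁; proj₂)
open import Data.Sum using (inj₁; inj₂)
open import Function using (_∘_; id)
open import Relation.Nullary using (¬_; Dec; yes; no; does; contradiction)
open import Relation.Nullary.Decidable using (dec-true; dec-false)
open import Relation.Binary.PropositionalEquality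

partnerUpℕ : (ℕ → Bool) → ℕ → ℕ
partnerUpℕ e k = if e k then suc k else k

partnerℕ : (ℕ → Bool) → ℕ → ℕ
partnerℕ e zero    = partnerUpℕ e zero
partnerℕ e (suc k) = if e k then k else partnerUpℕ e (suc k)

toℕ-partnerUp : ∀ {n} (S : Matching n) v → toℕ (partnerUp S v) ≡ partnerUpℕ (edge S) (toℕ v)
toℕ-partnerUp {n} S v with edge S (toℕ v) in e | suc (toℕ v) <? n
... | true  | yes lt = toℕ-fromℕ< lt
... | true  | no ¬lt = contradiction (inRange S _ e) ¬lt
... | false | _      = refl

toℕ-partner : ∀ {n} (S : Matching n) v → toℕ (partner S v) ≡ partnerℕ (edge S) (toℕ v)
toℕ-partner S zero = toℕ-partnerUp S zero
toℕ-partner S (suc j) with edge S (toℕ j)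
... | true  = toℕ-inject₁ j
... | false = toℕ-partnerUp S (suc j)

module _ (e : ℕ → Bool) where

  partnerℕ-down : ∀ {k} → e k ≡ true → partnerℕ e (suc k) ≡ k
  partnerℕ-down {k} ek = cong (λ b → if b then k else partnerUpℕ e (suc k)) ek

  partnerℕ-fixed₀ : e 0 ≡ false → partnerℕ e 0 ≡ 0
  partnerℕ-fixed₀ e0 = cong (λ b → if b then 1 else 0) e0

  partnerℕ-fixed : ∀ {k} → e k ≡ false → e (suc k) ≡ false → partnerℕ e (suc k) ≡ suc k
  partnerℕ-fixed {k} ek ek₊₁ =
    cong₂ (λ b c → if b then k else if c then suc (suc k) else suc k) ek ek₊₁

partnerℕ-up : ∀ {n} (S : Matching n) {k} → edge S k ≡ true → partnerℕ (edge S) k ≡ suc k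
partnerℕ-up S {zero} e0 = cong (λ b → if b then 1 else 0) e0
partnerℕ-up S {suc k} ek₊₁ with edge S k in ek
... | true  = contradiction (trans (sym ek₊₁) (disjoint S k ek)) λ ()
... | false = cong (λ b → if b then suc (suc k) else suc k) ek₊₁

partnerℕ-involutive : ∀ {n} (S : Matching n) k → partnerℕ (edge S) (partnerℕ (edge S) k) ≡ k
partnerℕ-involutive S zero with edge S 0 in e0
... | true  = partnerℕ-down (edge S) e0
... | false = partnerℕ-fixed₀ (edge S) e0
partnerℕ-involutive S (suc k) with edge S k in ek
... | true  = partnerℕ-up S ek
... | false with edge S (suc k) in ek₊₁
...   | true  = partnerℕ-down (edge S) ek₊₁
...   | false = partnerℕ-fixed (edge S) ek ek₊₁

partner-involutive : ∀ {n} (S : Matching n) v → partner S (partner S v) ≡ v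
partner-involutive S v = toℕ-injective (begin
  toℕ (partner S (partner S v))        ≡⟨ toℕ-partner S (partner S v) ⟩
  partnerℕ e (toℕ (partner S v))       ≡⟨ cong (partnerℕ e) (toℕ-partner S v) ⟩
  partnerℕ e (partnerℕ e (toℕ v))      ≡⟨ partnerℕ-involutive S (toℕ v) ⟩
  toℕ v                                ∎)
  where open ≡-Reasoning
        e = edge S

apply2-swap : ∀ {n} {f g : Coloring n} {S₁ S₂ : Matching n} →
              (∀ u → apply2 g S₁ S₂ u ≡ f u) → ∀ u → apply2 f S₂ S₁ u ≡ g u
apply2-swap {f = f} {g} {S₁} {S₂} g⟨S₁,S₂⟩≡f u = begin
  f (partner S₂ (partner S₁ u))                             ≡⟨ sym (g⟨S₁,S₂⟩≡f _) ⟩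
  g (partner S₁ (partner S₂ (partner S₂ (partner S₁ u))))   ≡⟨ cong (g ∘ partner S₁) (partner-involutive S₂ _) ⟩
  g (partner S₁ (partner S₁ u))                             ≡⟨ cong g (partner-involutive S₁ u) ⟩
  g u                                                       ∎
  where open ≡-Reasoning

alternate : {A : Set} → A → A → ℕ → A
alternate a b zero    = a
alternate a b (suc k) = alternate b a k

alternate-map : ∀ {A B : Set} (h : A → B) {a b} k → alternate (h a) (h b) k ≡ h (alternate a b k)
alternate-map h zero    = refl
alternate-map h (suc k) = alternate-map h k

alternate-suc-≢ : ∀ {A : Set} {a b : A} → a ≢ b → ∀ k → alternate a b (suc k) ≢ alternate a b k
alternate-suc-≢ a≢b zero    = ≢-sym a≢b
alternate-suc-≢ a≢b (suc k) = alternate-suc-≢ (≢-sym a≢b) k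

even odd : ℕ → Bool
even = alternate true false
odd  = even ∘ suc

even-suc : ∀ k → even (suc k) ≡ not (even k)
even-suc = alternate-map not

odd-suc : ∀ k → odd (suc k) ≡ not (odd k)
odd-suc = even-suc ∘ suc

alternate-even : ∀ {A : Set} {a b : A} k → even k ≡ true → alternate a b k ≡ a
alternate-even {a = a} {b} k ek = begin
  alternate a b k                                 ≡⟨ alternate-map (λ t → if t then a else b) {true} {false} k ⟩
  (if even k then a else b)                       ≡⟨ cong (λ t → if t then a else b) ek ⟩
  a                                               ∎
  where open ≡-Reasoning

does-true : ∀ {A : Set} (a? : Dec A) → does a? ≡ true → A
does-true (yes a) _ = a

module _ (p : ℕ → Bool) (p-suc : ∀ k → p (suc k) ≡ not (p k)) where

  pairing : (n : ℕ) → Matching (suc n)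
  pairing n = record
    { edge     = λ k → p k ∧ does (k <? n)
    ; inRange  = λ k e → s≤s (does-true (k <? n) (∧-conicalʳ (p k) _ e))
    ; disjoint = λ k e → cong (_∧ _) (trans (p-suc k) (cong not (∧-conicalˡ (p k) _ e)))
    }

  module _ {n : ℕ} where
    private
      e = edge (pairing n)

    pairing-edge : ∀ {k} → p k ≡ true → k < n → e k ≡ true
    pairing-edge {k} pk k<n = cong₂ _∧_ pk (dec-true (k <? n) k<n)

    pairing-no-edge : ∀ {k} → p k ≡ false → e k ≡ false
    pairing-no-edge pk = cong (_∧ _) pk

    pairing-no-edge-beyond : ∀ {k} → n ≤ k → e k ≡ false
    pairing-no-edge-beyond {k} n≤k = trans (cong (p k ∧_) (dec-false (k <? n) (≤⇒≯ n≤k))) (∧-zeroʳ (p k))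

  pairing-partner-top : ∀ {n} → p n ≡ true → partnerℕ (edge (pairing n)) n ≡ n
  pairing-partner-top {zero}  _    = partnerℕ-fixed₀ (edge (pairing 0)) (pairing-no-edge-beyond {n = 0} ≤-refl)
  pairing-partner-top {suc n} pn₊₁ =
    partnerℕ-fixed (edge (pairing (suc n)))
                   (pairing-no-edge {n = suc n} (not-injective (trans (sym (p-suc n)) pn₊₁)))
                   (pairing-no-edge-beyond {n = suc n} ≤-refl)

  pairing-swap : ∀ {A : Set} {n} (F H : ℕ → A) →
                 (∀ k → p k ≡ true → k < n → H k ≡ F (suc k) × H (suc k) ≡ F k) →
                 (p 0 ≡ false → H 0 ≡ F 0) →
                 (p n ≡ true → H n ≡ F n) →
                 ∀ v → F (toℕ (partner (pairing n) v)) ≡ H (toℕ v)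
  pairing-swap {n = n} F H swap fix₀ fixₙ v =
    trans (cong F (toℕ-partner (pairing n) v)) (swapℕ (toℕ v) (s≤s⁻¹ (toℕ<n v)))
    where
    e = edge (pairing n)
    swapℕ : ∀ u → u ≤ n → F (partnerℕ e u) ≡ H u
    swapℕ u u≤n with p u in pu
    swapℕ u u≤n | true with m≤n⇒m<n∨m≡n u≤n
    ... | inj₁ u<n  = trans (cong F (partnerℕ-up (pairing n) (pairing-edge pu u<n)))
                            (sym (proj₁ (swap u pu u<n)))
    ... | inj₂ refl = trans (cong F (pairing-partner-top pu)) (sym (fixₙ pu))
    swapℕ zero    _   | false =
      trans (cong F (partnerℕ-fixed₀ e (pairing-no-edge {n = n} pu))) (sym (fix₀ pu))
    swapℕ (suc k) k<n | false =
      trans (cong F (partnerℕ-down e (pairing-edge pk k<n))) (sym (proj₂ (swap k pk k<n)))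
      where pk : p k ≡ true
            pk = not-injective (trans (sym (p-suc k)) pu)

≢∧≢⇒≡ : {x y z : Fin 2} → x ≢ y → x ≢ z → y ≡ z
≢∧≢⇒≡ {zero}     {zero}               x≢y _   = contradiction refl x≢y
≢∧≢⇒≡ {zero}     {suc zero} {zero}     _   x≢z = contradiction refl x≢z
≢∧≢⇒≡ {zero}     {suc zero} {suc zero} _   _   = refl
≢∧≢⇒≡ {suc zero} {suc zero}           x≢y _   = contradiction refl x≢y
≢∧≢⇒≡ {suc zero} {zero}     {suc zero} _   x≢z = contradiction refl x≢z
≢∧≢⇒≡ {suc zero} {zero}     {zero}     _   _   = refl

record EndSwapped (n : ℕ) (F G : ℕ → Fin 2) : Set where
  field
    agree       : ∀ k → 1 ≤ k → k < n → F k ≡ G k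
    alternates  : ∀ k → 1 ≤ k → suc k < n → F k ≢ F (suc k)
    start       : F 0 ≡ G n
    end         : G 0 ≡ F n
    ends-differ : F 0 ≢ G 0
open EndSwapped

EndSwapped-sym : ∀ {n F G} → EndSwapped n F G → EndSwapped n G F
EndSwapped-sym sw = record
  { agree       = λ k 1≤k k<n → sym (agree sw k 1≤k k<n)
  ; alternates  = λ k 1≤k k₊₁<n Gk≡Gk₊₁ → alternates sw k 1≤k k₊₁<n
      (trans (agree sw k 1≤k (<⇒≤ k₊₁<n)) (trans Gk≡Gk₊₁ (sym (agree sw (suc k) (s≤s z≤n) k₊₁<n))))
  ; start       = end sw
  ; end         = start sw
  ; ends-differ = ≢-sym (ends-differ sw)
  }

EndSwapped-1<n : ∀ {n F G} → EndSwapped n F G → F 1 ≢ G 0 → 1 < n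
EndSwapped-1<n {zero}        sw _      = contradiction (start sw) (ends-differ sw)
EndSwapped-1<n {suc zero}    sw F₁≢G₀ = contradiction (sym (end sw)) F₁≢G₀
EndSwapped-1<n {suc (suc n)} _  _      = s≤s (s≤s z≤n)

EndSwapped-G₁≡F₀ : ∀ {n F G} → EndSwapped n F G → F 1 ≢ G 0 → G 1 ≡ F 0
EndSwapped-G₁≡F₀ sw F₁≢G₀ =
  trans (sym (agree sw 1 ≤-refl (EndSwapped-1<n sw F₁≢G₀)))
        (≢∧≢⇒≡ (≢-sym F₁≢G₀) (≢-sym (ends-differ sw)))

evenPairs oddPairs : (n : ℕ) → Matching (suc n)
evenPairs = pairing even even-suc
oddPairs  = pairing odd odd-suc

module _ {n : ℕ} {F G : ℕ → Fin 2} (sw : EndSwapped n F G) (F₁≡G₀ : F 1 ≡ G 0) where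
  private
    a = F 0
    b = G 0

  F≡alternate : ∀ k → k < n → F k ≡ alternate a b k
  F≡alternate zero          _       = refl
  F≡alternate (suc zero)    _       = F₁≡G₀
  F≡alternate (suc (suc k)) k₊₂<n =
    ≢∧≢⇒≡ (alternates sw (suc k) (s≤s z≤n) k₊₂<n ∘ trans (F≡alternate (suc k) (<⇒≤ k₊₂<n)))
          (alternate-suc-≢ (ends-differ sw) (suc k) ∘ sym)

  G≡alternate : ∀ k → 1 ≤ k → k < n → G k ≡ alternate a b k
  G≡alternate k 1≤k k<n = trans (sym (agree sw k 1≤k k<n)) (F≡alternate k k<n)

  even-pairs-step : ∀ v → F (toℕ (partner (evenPairs n) v)) ≡ alternate b a (toℕ v)
  even-pairs-step =
    pairing-swap even even-suc F (alternate b a) swap (λ ()) (λ en → trans (alternate-even n en) (end sw))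
    where
    swap : ∀ k → even k ≡ true → k < n → alternate b a k ≡ F (suc k) × alternate a b k ≡ F k
    swap k ek k<n with m≤n⇒m<n∨m≡n k<n
    ... | inj₁ k₊₁<n = sym (F≡alternate (suc k) k₊₁<n) , sym (F≡alternate k k<n)
    ... | inj₂ k₊₁≡n = trans (alternate-even k ek) (trans (end sw) (cong F (sym k₊₁≡n))) ,
                       sym (F≡alternate k k<n)

  odd-pairs-step : ∀ v → alternate b a (toℕ (partner (oddPairs n) v)) ≡ G (toℕ v)
  odd-pairs-step = pairing-swap odd odd-suc (alternate b a) G swap (λ _ → refl)
                                 (λ on → trans (sym (start sw)) (sym (alternate-even (suc n) on)))
    where
    swap : ∀ k → odd k ≡ true → k < n → G k ≡ alternate a b k × G (suc k) ≡ alternate b a k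
    swap (suc k) ok k₊₁<n with m≤n⇒m<n∨m≡n k₊₁<n
    ... | inj₁ k₊₂<n = G≡alternate (suc k) (s≤s z≤n) k₊₁<n , G≡alternate (suc (suc k)) (s≤s z≤n) k₊₂<n
    ... | inj₂ k₊₂≡n = G≡alternate (suc k) (s≤s z≤n) k₊₁<n ,
                       trans (cong G k₊₂≡n) (trans (sym (start sw)) (sym (alternate-even (suc (suc k)) ok)))

  pairs-solution : ∀ v → F (toℕ (partner (evenPairs n) (partner (oddPairs n) v))) ≡ G (toℕ v)
  pairs-solution v = trans (even-pairs-step (partner (oddPairs n) v)) (odd-pairs-step v)

-- A colouring read on natural-number indices; the value beyond n is junk and never used.
extend : ∀ {n} → Coloring (suc n) → ℕ → Fin 2
extend {n} f k with k <? suc n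
... | yes k<1+n = f (fromℕ< k<1+n)
... | no  _     = zero

module _ {n : ℕ} (f : Coloring (suc n)) where

  extend-fromℕ< : ∀ {k} (k<1+n : k < suc n) → extend f k ≡ f (fromℕ< k<1+n)
  extend-fromℕ< {k} k<1+n with k <? suc n
  ... | yes k<1+n′ = cong f (fromℕ<-cong k k refl k<1+n′ k<1+n)
  ... | no  k≮1+n  = contradiction k<1+n k≮1+n

  extend-toℕ : ∀ v → extend f (toℕ v) ≡ f v
  extend-toℕ v = trans (extend-fromℕ< (toℕ<n v)) (cong f (fromℕ<-toℕ v (toℕ<n v)))

  extend-fromℕ : extend f n ≡ f (fromℕ n)
  extend-fromℕ = subst (λ m → extend f m ≡ f (fromℕ n)) (toℕ-fromℕ n) (extend-toℕ (fromℕ n))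

apply2-from-extend : ∀ {n} {f g : Coloring (suc n)} {S₁ S₂ : Matching (suc n)} →
                     (∀ v → extend f (toℕ (partner S₁ (partner S₂ v))) ≡ extend g (toℕ v)) →
                     ∀ u → apply2 f S₁ S₂ u ≡ g u
apply2-from-extend {f = f} {g} h u = trans (sym (extend-toℕ f _)) (trans (h u) (extend-toℕ g u))

AlternatingMiddle : ∀ {n} → Coloring (suc n) → Coloring (suc n) → Set
AlternatingMiddle {n} f g =
  ∀ (i j : Fin (suc n)) → toℕ j ≡ suc (toℕ i) → 1 ≤ toℕ i → suc (toℕ j) ≤ n →
  (f i ≡ g i) × (f j ≡ g j) × ¬ (f i ≡ f j)

middle-at : ∀ {n} {f g : Coloring (suc n)} → AlternatingMiddle f g →
            ∀ k → 1 ≤ k → suc k < n →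
            extend f k ≡ extend g k × extend f (suc k) ≡ extend g (suc k) × extend f k ≢ extend f (suc k)
middle-at {n} {f} {g} middle k 1≤k k₊₁<n =
  from-fin (middle i j j≡1+i (subst (1 ≤_) (sym i≡k) 1≤k) (subst (λ m → suc m ≤ n) (sym j≡1+k) k₊₁<n))
  where
  k₊₁<1+n = s≤s (<⇒≤ k₊₁<n)
  k<1+n   = <⇒≤ k₊₁<1+n
  i = fromℕ< k<1+n
  j = fromℕ< k₊₁<1+n
  i≡k   = toℕ-fromℕ< k<1+n
  j≡1+k = toℕ-fromℕ< k₊₁<1+n
  j≡1+i = trans j≡1+k (cong suc (sym i≡k))
  from-fin : (f i ≡ g i) × (f j ≡ g j) × f i ≢ f j →
             extend f k ≡ extend g k × extend f (suc k) ≡ extend g (suc k) × extend f k ≢ extend f (suc k)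
  from-fin (fi≡gi , fj≡gj , fi≢fj) =
    trans (extend-fromℕ< f k<1+n) (trans fi≡gi (sym (extend-fromℕ< g k<1+n))) ,
    trans (extend-fromℕ< f k₊₁<1+n) (trans fj≡gj (sym (extend-fromℕ< g k₊₁<1+n))) ,
    λ eq → fi≢fj (trans (sym (extend-fromℕ< f k<1+n)) (trans eq (extend-fromℕ< f k₊₁<1+n)))

map-filter : ∀ {A B : Set} {P : B → Set} (f : A → B) (P? : ∀ y → Dec (P y)) xs →
             map f (filter (P? ∘ f) xs) ≡ filter P? (map f xs)
map-filter f P? []       = refl
map-filter f P? (x ∷ xs) with does (P? (f x))
... | true  = cong (f x ∷_) (map-filter f P? xs)
... | false = map-filter f P? xs

count-tabulate : ∀ {n} c (f : Coloring n) → count c f ≡ length (filter (_≟ c) (tabulate f))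
count-tabulate {n} c f = begin
  length (filter ((_≟ c) ∘ f) (tabulate id))            ≡⟨ length-map f (filter ((_≟ c) ∘ f) (tabulate id)) ⟨
  length (map f (filter ((_≟ c) ∘ f) (tabulate id)))    ≡⟨ cong length (map-filter f (_≟ c) (tabulate id)) ⟩
  length (filter (_≟ c) (map f (tabulate id)))          ≡⟨ cong (length ∘ filter (_≟ c)) (map-tabulate id f) ⟩
  length (filter (_≟ c) (tabulate f))                   ∎
  where open ≡-Reasoning

zeros : List (Fin 2) → ℕ
zeros xs = length (filter (_≟ zero) xs)

zeros-middle : (a x b y : Fin 2) → a ≢ b → zeros (a ∷ x ∷ b ∷ []) ≡ zeros (b ∷ y ∷ a ∷ []) → x ≡ y
zeros-middle zero       zero       (suc zero) zero       _   _  = refl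
zeros-middle zero       (suc zero) (suc zero) (suc zero) _   _  = refl
zeros-middle (suc zero) zero       zero       zero       _   _  = refl
zeros-middle (suc zero) (suc zero) zero       (suc zero) _   _  = refl
zeros-middle zero       zero       (suc zero) (suc zero) _   ()
zeros-middle zero       (suc zero) (suc zero) zero       _   ()
zeros-middle (suc zero) zero       zero       (suc zero) _   ()
zeros-middle (suc zero) (suc zero) zero       zero       _   ()
zeros-middle zero       _          zero       _          a≢b _  = contradiction refl a≢b
zeros-middle (suc zero) _          (suc zero) _          a≢b _  = contradiction refl a≢b

middle-forced : (f g : Coloring 3) → Consistent f g →
                f zero ≡ g (fromℕ 2) → g zero ≡ f (fromℕ 2) → f zero ≢ g zero →
                f (suc zero) ≡ g (suc zero)
middle-forced f g consistent f₀≡g₂ g₀≡f₂ f₀≢g₀ =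
  zeros-middle (f zero) (f (suc zero)) (g zero) (g (suc zero)) f₀≢g₀ (begin
    zeros (f zero ∷ f (suc zero) ∷ g zero ∷ [])   ≡⟨ cong (λ x → zeros (f zero ∷ f (suc zero) ∷ x ∷ [])) g₀≡f₂ ⟩
    zeros (tabulate f)                            ≡⟨ count-tabulate zero f ⟨
    count zero f                                  ≡⟨ consistent zero ⟩
    count zero g                                  ≡⟨ count-tabulate zero g ⟩
    zeros (tabulate g)                            ≡⟨ cong (λ x → zeros (g zero ∷ g (suc zero) ∷ x ∷ [])) f₀≡g₂ ⟨
    zeros (g zero ∷ g (suc zero) ∷ f zero ∷ [])   ∎)
  where open ≡-Reasoning

agree-in-middle : ∀ {n} (f g : Coloring (suc n)) → Consistent f g → AlternatingMiddle f g →
                  f zero ≡ g (fromℕ n) → g zero ≡ f (fromℕ n) → f zero ≢ g zero →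
                  ∀ k → 1 ≤ k → k < n → extend f k ≡ extend g k
agree-in-middle f g _ middle _ _ _ (suc (suc k)) _ k₊₂<n =
  proj₁ (proj₂ (middle-at middle (suc k) (s≤s z≤n) k₊₂<n))
agree-in-middle f g consistent middle f₀≡gₙ g₀≡fₙ f₀≢g₀ (suc zero) _ 1<n with m≤n⇒m<n∨m≡n 1<n
... | inj₁ 2<n  = proj₁ (middle-at middle 1 ≤-refl 2<n)
... | inj₂ refl = trans (extend-toℕ f (suc zero))
                        (trans (middle-forced f g consistent f₀≡gₙ g₀≡fₙ f₀≢g₀) (sym (extend-toℕ g (suc zero))))

endSwapped : ∀ {n} (f g : Coloring (suc n)) → Consistent f g → AlternatingMiddle f g →
             f zero ≡ g (fromℕ n) → g zero ≡ f (fromℕ n) → f zero ≢ g zero →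
             EndSwapped n (extend f) (extend g)
endSwapped f g consistent middle f₀≡gₙ g₀≡fₙ f₀≢g₀ = record
  { agree       = agree-in-middle f g consistent middle f₀≡gₙ g₀≡fₙ f₀≢g₀
  ; alternates  = λ k 1≤k k₊₁<n → proj₂ (proj₂ (middle-at middle k 1≤k k₊₁<n))
  ; start       = trans (extend-toℕ f zero) (trans f₀≡gₙ (sym (extend-fromℕ g)))
  ; end         = trans (extend-toℕ g zero) (trans g₀≡fₙ (sym (extend-fromℕ f)))
  ; ends-differ = λ eq → f₀≢g₀ (trans (sym (extend-toℕ f zero)) (trans eq (extend-toℕ g zero)))
  }

lemma8 : (n : ℕ) (f g : Coloring (suc n)) → Consistent f g →
         (∀ (i j : Fin (suc n)) → toℕ j ≡ suc (toℕ i) → 1 ≤ toℕ i → suc (toℕ j) ≤ n →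
            (f i ≡ g i) × (f j ≡ g j) × ¬ (f i ≡ f j)) →
         f zero ≡ g (fromℕ n) → g zero ≡ f (fromℕ n) → ¬ (f zero ≡ g zero) →
         Σ (Matching (suc n)) (λ S₁ → Σ (Matching (suc n)) (λ S₂ → ∀ u → apply2 f S₁ S₂ u ≡ g u))
lemma8 n f g consistent middle f₀≡gₙ g₀≡fₙ f₀≢g₀ = solve (extend f 1 ≟ extend g 0)
  where
  sw = endSwapped f g consistent middle f₀≡gₙ g₀≡fₙ f₀≢g₀
  solve : Dec (extend f 1 ≡ extend g 0) →
          Σ (Matching (suc n)) (λ S₁ → Σ (Matching (suc n)) (λ S₂ → ∀ u → apply2 f S₁ S₂ u ≡ g u))
  solve (yes F₁≡G₀) = evenPairs n , oddPairs n , apply2-from-extend (pairs-solution sw F₁≡G₀)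
  solve (no  F₁≢G₀) = oddPairs n , evenPairs n ,
    apply2-swap (apply2-from-extend (pairs-solution (EndSwapped-sym sw) (EndSwapped-G₁≡F₀ sw F₁≢G₀)))
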